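{- Let $X=\operatorname{Cay}(\mathbb{Z}_n,S)$ be a connected circulant graph of order $n$ that is not twin-free, and let $d$ be its valency. Then: (1) there is a connected circulant graph $Y$ and an integer $m\ge2$ such that $X\cong Y\wr\overline{K_m}$ and $d=\delta m$, where $\delta$ is the valency of $Y$; (2) if $d$ is prime, then $X\cong K_{d,d}$; (3) if $d=4$, then $X$ is isomorphic either to $K_{4,4}$ or to $C_\ell\wr\overline{K_2}$ with $\ell=|V(X)|/2$; moreover, in the second case the unique twin of $0$ is $n/2$.
   Context: All graphs are finite, undirected and simple. $\operatorname{Cay}(\mathbb{Z}_n,S)$ (with $S\subseteq\mathbb{Z}_n\setminus\{0\}$, $S=-S$) has vertex set $\mathbb{Z}_n$ and $v\sim w$ iff $w-v\in S$. A graph is twin-free if there do not exist two distinct vertices $v,w$ with the same set of neighbours; such $v,w$ are twins. $\overline{K_m}$ is the edgeless graph on $m$ vertices; $C_\ell$ is the cycle of length $\ell$. The wreath (lexicographic) product $X\wr Y$ is obtained by replacing each vertex of $X$ by a copy of $Y$, with vertices in two different copies adjacent iff the corresponding vertices of $X$ are adjacent. -}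

module Defs where

open import Data.Bool using (Bool; true; false; _∧_; _∨_; _xor_)
open import Data.Nat using (ℕ; zero; suc; _+_; _*_; _∸_; NonZero; _<ᵇ_; _≡ᵇ_)
open import Data.Nat.DivMod using (_mod_)
open import Data.Fin using (Fin; toℕ; remQuot; _≟_)
open import Data.Fin.Subset using (Subset; _∈_; _∉_; ∣_∣)
open import Data.Vec using (lookup; tabulate)
open import Data.Product using (Σ; _×_; ∃; proj₁; proj₂)
open import Relation.Nullary using (¬_; does)
open import Relation.Binary.PropositionalEquality using (_≡_; _≢_)
open import Function.Bundles using (_↔_; Inverse)

-- A graph on vertex set Fin N, adjacency as a Bool-valued relation.
-- (Simplicity holds by construction for all graphs built below.)
record Graph : Set where
  field
    N   : ℕ
    Adj : Fin N → Fin N → Bool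
open Graph public

record _≅_ (G H : Graph) : Set where
  field
    bij : Fin (N G) ↔ Fin (N H)
    preserves : ∀ u v → Adj H (Inverse.to bij u) (Inverse.to bij v) ≡ Adj G u v
infix 4 _≅_

data Walk (G : Graph) : Fin (N G) → Fin (N G) → Set where
  [] : ∀ {v} → Walk G v v
  _∷_ : ∀ {u v w} → Adj G u v ≡ true → Walk G v w → Walk G u w

Connected : Graph → Set
Connected G = ∀ u v → Walk G u v

degree : (G : Graph) → Fin (N G) → ℕ
degree G v = ∣ tabulate (Adj G v) ∣

Regular : Graph → ℕ → Set
Regular G d = ∀ v → degree G v ≡ d

Twins : (G : Graph) → Fin (N G) → Fin (N G) → Set
Twins G v w = v ≢ w × (∀ u → Adj G v u ≡ Adj G w u)

TwinFree : Graph → Set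
TwinFree G = ¬ (Σ (Fin (N G)) λ v → Σ (Fin (N G)) λ w → Twins G v w)

module _ (n : ℕ) .{{_ : NonZero n}} where
  0ₙ : Fin n
  0ₙ = 0 mod n

  negₙ : Fin n → Fin n
  negₙ a = (n ∸ toℕ a) mod n

  subₙ : Fin n → Fin n → Fin n
  subₙ w v = ((n + toℕ w) ∸ toℕ v) mod n

  ConnectionSet : Subset n → Set
  ConnectionSet S = (0ₙ ∉ S) × (∀ a → a ∈ S → negₙ a ∈ S)

-- Cay(ℤ_n, S): v ~ w iff w - v ∈ S  (S is assumed to be a connection set separately)
Cay : (n : ℕ) .{{_ : NonZero n}} → Subset n → Graph
Cay n S = record { N = n ; Adj = λ v w → lookup S (subₙ n w v) }

Empty : ℕ → Graph
Empty m = record { N = m ; Adj = λ _ _ → false }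

-- complete bipartite graph K_{a,b}: vertices 0..a-1 on one side, a..a+b-1 on the other
CompleteBipartite : ℕ → ℕ → Graph
CompleteBipartite a b = record { N = a + b ; Adj = λ u v → (toℕ u <ᵇ a) xor (toℕ v <ᵇ a) }

-- cycle C_ℓ on Fin ℓ: i ~ j iff j ≡ i ± 1 (mod ℓ)   (used only for ℓ ≥ 3)
succAdj : (ℓ : ℕ) → ℕ → ℕ → Bool
succAdj ℓ i j = (j ≡ᵇ suc i) ∨ ((suc i ≡ᵇ ℓ) ∧ (j ≡ᵇ 0))

Cycle : ℕ → Graph
Cycle ℓ = record { N = ℓ ; Adj = λ i j → succAdj ℓ (toℕ i) (toℕ j) ∨ succAdj ℓ (toℕ j) (toℕ i) }

-- wreath (lexicographic) product X ≀ Y on Fin (N X * N Y), vertex u ↦ remQuot u = (x , y):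
-- (x,y) ~ (x',y') iff x ~ x' in X, or x = x' and y ~ y' in Y
_≀_ : Graph → Graph → Graph
X ≀ Y = record { N = N X * N Y ; Adj = adj }
  where
  adj : Fin (N X * N Y) → Fin (N X * N Y) → Bool
  rq : Fin (N X * N Y) → Fin (N X) × Fin (N Y)
  rq = remQuot {N X} (N Y)
  adj u v = Adj X (proj₁ (rq u)) (proj₁ (rq v))
          ∨ (does (proj₁ (rq u) ≟ proj₁ (rq v)) ∧ Adj Y (proj₂ (rq u)) (proj₂ (rq v)))
infixl 7 _≀_

-- Read S as a Boolean function s on ℕ of period n, so that u ~ v iff s (v − u). Two vertices v, w
-- are twins iff w − v is a period of s; hence twins exist iff the least positive period k of s is a
-- proper divisor of n. Then u ↦ (u mod k, u div k) exhibits X as Y ≀ K̄ₘ with Y = Cay(ℤₖ, S mod k)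
-- and m = n/k ≥ 2, so d = δm. If d is prime or d = 4, then δ ∈ {1, 2}. In a connected circulant of
-- valency one the unique generator a satisfies 2a = 0 and generates ℤₖ, so Y = K₂ and
-- X = K₂ ≀ K̄ₘ = K_{m,m}; in valency two the connection set is {a, −a} with a a unit, and
-- multiplication by a⁻¹ maps Y onto Cₖ. When n = 2k the twins of 0 are the nonzero multiples of k
-- below n, i.e. k alone.

module Submission where

open import Defs
open import Data.Nat using (ℕ; _*_; _≤_; NonZero)
open import Data.Nat.Primality using (Prime)
open import Data.Fin using (Fin; toℕ)
open import Data.Fin.Subset using (Subset)
open import Data.Product using (Σ; _×_)
open import Data.Sum using (_⊎_)
open import Relation.Nullary using (¬_)
open import Relation.Binary.PropositionalEquality using (_≡_)
open import Function.Bundles using (_⇔_)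

open import Data.Bool using (Bool; true; false; if_then_else_; _∨_; _xor_)
import Data.Bool as Bool
open import Data.Bool.Properties using (∨-identityʳ; ∧-zeroʳ; T-≡; T-∨; T-∧) renaming (_≟_ to _≟ᵇ_)
open import Data.Empty using (⊥-elim)
open import Data.Fin using (_↑ʳ_; cast; combine; fromℕ<; inject≤; remQuot; splitAt)
open import Data.Fin.Patterns using (0F; 1F)
open import Data.Fin.Properties
  using ( *↔×; +↔⊎; all?; cast-involutive; combine-remQuot; remQuot-combine; splitAt⁻¹-↑ʳ; splitAt⁻¹-↑ˡ
        ; toℕ-↑ʳ; toℕ-↑ˡ; toℕ-cast; toℕ-combine; toℕ-fromℕ<; toℕ-inject≤; toℕ-injective; toℕ<n )
open import Data.Fin.Subset using (_∈_; _∉_; ∣_∣)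
open import Data.Nat
open import Data.Nat.DivMod
open import Data.Nat.Divisibility using (n∣m*n; hasNonTrivialDivisor)
open import Data.Nat.Induction using (<-rec)
open import Data.Nat.Primality using (prime⇒nonTrivial; prime⇒¬composite)
open import Data.Nat.Properties
open import Data.Product using (_,_; proj₁; proj₂; uncurry)
open import Data.Product.Algebra using (×-comm)
open import Data.Product.Function.NonDependent.Propositional using (_×-↔_)
open import Data.Sum using (inj₁; inj₂; [_,_]′)
import Data.Sum as Sum
open import Data.Sum.Function.Propositional using (_⊎-⇔_)
open import Data.Vec using (lookup; tabulate; _∷_; [])
open import Data.Vec.Properties using (lookup∘tabulate; lookup⇒[]=; []=⇒lookup)
open import Function using (_∘_)
open import Function.Bundles using (_↔_; Inverse; Equivalence; mk↔ₛ′; mk⇔)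
open import Function.Construct.Composition using (_⇔-∘_)
open import Function.Construct.Symmetry using (⇔-sym)
open import Function.Properties.Inverse using (↔-sym; ↔-trans; ↔-refl)
open import Relation.Nullary using (yes; no)
open import Relation.Nullary.Decidable using (_×-dec_; map′)
open import Relation.Unary using (Decidable)
open import Relation.Binary.PropositionalEquality

-- Congruence modulo k

IsPeriod : {A : Set} → (ℕ → A) → ℕ → Set
IsPeriod f p = ∀ x → f (x + p) ≡ f x

module Congruence (k : ℕ) .{{_ : NonZero k}} where

  infix 4 _≈_
  _≈_ : ℕ → ℕ → Set
  x ≈ y = x % k ≡ y % k

  %-≈ : ∀ x → x % k ≈ x
  %-≈ x = m%n%n≡m%n x k

  +-congʳ : ∀ {x y} c → x ≈ y → x + c ≈ y + c
  +-congʳ {x} {y} c x≈y = begin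
    (x + c) % k           ≡⟨ %-distribˡ-+ x c k ⟩
    (x % k + c % k) % k   ≡⟨ cong (λ z → (z + c % k) % k) x≈y ⟩
    (y % k + c % k) % k   ≡⟨ %-distribˡ-+ y c k ⟨
    (y + c) % k           ∎
    where open ≡-Reasoning

  +-congˡ : ∀ {x y} c → x ≈ y → c + x ≈ c + y
  +-congˡ {x} {y} c x≈y =
    trans (cong (_% k) (+-comm c x)) (trans (+-congʳ c x≈y) (cong (_% k) (+-comm y c)))

  +-cong : ∀ {x y u v} → x ≈ y → u ≈ v → x + u ≈ y + v
  +-cong {y = y} {u} x≈y u≈v = trans (+-congʳ u x≈y) (+-congˡ y u≈v)

  *-congʳ : ∀ {x y} c → x ≈ y → x * c ≈ y * c
  *-congʳ {x} {y} c x≈y = begin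
    (x * c) % k               ≡⟨ %-distribˡ-* x c k ⟩
    (x % k * (c % k)) % k     ≡⟨ cong (λ z → (z * (c % k)) % k) x≈y ⟩
    (y % k * (c % k)) % k     ≡⟨ %-distribˡ-* y c k ⟨
    (y * c) % k               ∎
    where open ≡-Reasoning

  *-congˡ : ∀ {x y} c → x ≈ y → c * x ≈ c * y
  *-congˡ {x} {y} c x≈y =
    trans (cong (_% k) (*-comm c x)) (trans (*-congʳ c x≈y) (cong (_% k) (*-comm y c)))

  0%k≡0 : 0 % k ≡ 0
  0%k≡0 = m<n⇒m%n≡m (>-nonZero⁻¹ k)

  k≈0 : k ≈ 0
  k≈0 = trans (n%n≡0 k) (sym 0%k≡0)

  +k≈ : ∀ x → x + k ≈ x
  +k≈ x = [m+n]%n≡m%n x k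

  +*k≈ : ∀ x j → x + j * k ≈ x
  +*k≈ x j = [m+kn]%n≡m%n x j k

  +-cancelʳ : ∀ {x y} c → x + c ≈ y + c → x ≈ y
  +-cancelʳ {x} {y} c x+c≈y+c =
    trans (sym (+c+c⁻≈ x)) (trans (+-congʳ c⁻ x+c≈y+c) (+c+c⁻≈ y))
    where
    c⁻ = k ∸ c % k
    +c+c⁻≈ : ∀ z → z + c + c⁻ ≈ z
    +c+c⁻≈ z = begin
      (z + c + c⁻) % k           ≡⟨ cong (_% k) (+-assoc z c c⁻) ⟩
      (z + (c + c⁻)) % k         ≡⟨ +-congˡ z (+-congʳ c⁻ (sym (%-≈ c))) ⟩
      (z + (c % k + c⁻)) % k     ≡⟨ cong (λ w → (z + w) % k) (m+[n∸m]≡n (m%n≤n c k)) ⟩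
      (z + k) % k                ≡⟨ +k≈ z ⟩
      z % k                      ∎
      where open ≡-Reasoning

  k+a∸b+b≈a : ∀ a b → b < k → k + a ∸ b + b ≈ a
  k+a∸b+b≈a a b b<k = begin
    (k + a ∸ b + b) % k   ≡⟨ cong (_% k) (m∸n+n≡m (≤-trans (<⇒≤ b<k) (m≤m+n k a))) ⟩
    (k + a) % k           ≡⟨ cong (_% k) (+-comm k a) ⟩
    (a + k) % k           ≡⟨ +k≈ a ⟩
    a % k                 ∎
    where open ≡-Reasoning

  +-≈⇒≈-∸ : ∀ {x a b} → b < k → x + b ≈ a → x ≈ k + a ∸ b
  +-≈⇒≈-∸ {a = a} {b} b<k x+b≈a = +-cancelʳ b (trans x+b≈a (sym (k+a∸b+b≈a a b b<k)))

  ≈⇒≡ : ∀ {x y} → x < k → y < k → x ≈ y → x ≡ y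
  ≈⇒≡ x<k y<k x≈y = trans (sym (m<n⇒m%n≡m x<k)) (trans x≈y (m<n⇒m%n≡m y<k))

  module Periodic {A : Set} (f : ℕ → A) (f-periodic : IsPeriod f k) where

    f[x+jk]≡f[x] : ∀ x j → f (x + j * k) ≡ f x
    f[x+jk]≡f[x] x zero    = cong f (+-identityʳ x)
    f[x+jk]≡f[x] x (suc j) = begin
      f (x + (k + j * k))   ≡⟨ cong f (+-assoc x k (j * k)) ⟨
      f (x + k + j * k)     ≡⟨ cong f (+-comm (x + k) (j * k)) ⟩
      f (j * k + (x + k))   ≡⟨ cong f (+-assoc (j * k) x k) ⟨
      f (j * k + x + k)     ≡⟨ f-periodic (j * k + x) ⟩
      f (j * k + x)         ≡⟨ cong f (+-comm (j * k) x) ⟩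
      f (x + j * k)         ≡⟨ f[x+jk]≡f[x] x j ⟩
      f x                   ∎
      where open ≡-Reasoning

    f[x%k]≡f[x] : ∀ x → f (x % k) ≡ f x
    f[x%k]≡f[x] x = trans (sym (f[x+jk]≡f[x] (x % k) (x / k))) (cong f (sym (m≡m%n+[m/n]*n x k)))

    ≈⇒f≡ : ∀ {x y} → x ≈ y → f x ≡ f y
    ≈⇒f≡ {x} {y} x≈y = trans (sym (f[x%k]≡f[x] x)) (trans (cong f x≈y) (f[x%k]≡f[x] y))

-- Counting the points where a Boolean function holds

count : ℕ → (ℕ → Bool) → ℕ
count zero    f = 0
count (suc n) f = (if f 0 then 1 else 0) + count n (f ∘ suc)

∣tabulate∣≡count : ∀ n (f : ℕ → Bool) → ∣ tabulate {n = n} (f ∘ toℕ) ∣ ≡ count n f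
∣tabulate∣≡count zero    f = refl
∣tabulate∣≡count (suc n) f with f 0
... | true  = cong suc (∣tabulate∣≡count n (f ∘ suc))
... | false = ∣tabulate∣≡count n (f ∘ suc)

count-cong : ∀ n {f g : ℕ → Bool} → (∀ x → x < n → f x ≡ g x) → count n f ≡ count n g
count-cong zero    f≡g = refl
count-cong (suc n) f≡g =
  cong₂ _+_ (cong (λ b → if b then 1 else 0) (f≡g 0 z<s)) (count-cong n (λ x x<n → f≡g (suc x) (s<s x<n)))

count-+ : ∀ a b f → count (a + b) f ≡ count a f + count b (λ x → f (a + x))
count-+ zero    b f = refl
count-+ (suc a) b f = trans (cong (_ +_) (count-+ a b (f ∘ suc))) (sym (+-assoc (if f 0 then 1 else 0) _ _))

module PeriodicCount (k : ℕ) (f : ℕ → Bool) (f-periodic : IsPeriod f k) where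

  count-shift : ∀ c → count k (λ x → f (x + c)) ≡ count k f
  count-shift zero    = count-cong k (λ x _ → cong f (+-identityʳ x))
  count-shift (suc c) = begin
    count k (λ x → f (x + suc c))          ≡⟨ count-cong k (λ x _ → cong f (+-suc x c)) ⟩
    count k (λ x → f (suc x + c))          ≡⟨ +-cancelʳ-≡ _ _ _ rotate ⟩
    count k (λ x → f (x + c))              ≡⟨ count-shift c ⟩
    count k f                              ∎
    where
    open ≡-Reasoning
    g : ℕ → Bool
    g x = f (x + c)
    g[k+0]≡g[0] : g (k + 0) ≡ g 0
    g[k+0]≡g[0] = trans (cong f (trans (cong (_+ c) (+-identityʳ k)) (+-comm k c))) (f-periodic c)
    -- both sides count g on {0, …, k}
    rotate : count k (g ∘ suc) + (if g 0 then 1 else 0) ≡ count k g + (if g 0 then 1 else 0)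
    rotate = begin
      count k (g ∘ suc) + (if g 0 then 1 else 0)   ≡⟨ +-comm (count k (g ∘ suc)) _ ⟩
      count (1 + k) g                               ≡⟨ cong (λ z → count z g) (+-comm 1 k) ⟩
      count (k + 1) g                               ≡⟨ count-+ k 1 g ⟩
      count k g + ((if g (k + 0) then 1 else 0) + 0) ≡⟨ cong (λ b → count k g + ((if b then 1 else 0) + 0)) g[k+0]≡g[0] ⟩
      count k g + ((if g 0 then 1 else 0) + 0)     ≡⟨ cong (count k g +_) (+-identityʳ _) ⟩
      count k g + (if g 0 then 1 else 0)            ∎

  count-* : ∀ j → count (j * k) f ≡ j * count k f
  count-* zero    = refl
  count-* (suc j) = begin
    count (k + j * k) f                          ≡⟨ count-+ k (j * k) f ⟩
    count k f + count (j * k) (λ x → f (k + x))  ≡⟨ cong (count k f +_) (count-cong (j * k) f[k+x]≡f[x]) ⟩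
    count k f + count (j * k) f                  ≡⟨ cong (count k f +_) (count-* j) ⟩
    count k f + j * count k f                    ∎
    where
    open ≡-Reasoning
    f[k+x]≡f[x] : ∀ x → x < j * k → f (k + x) ≡ f x
    f[k+x]≡f[x] x _ = trans (cong f (+-comm k x)) (f-periodic x)

count≡0⇒none : ∀ k f → count k f ≡ 0 → ∀ x → x < k → f x ≡ false
count≡0⇒none (suc k) f c≡0 x x<k with f 0 in f0
count≡0⇒none (suc k) f () x x<k | true
count≡0⇒none (suc k) f c≡0 zero    _         | false = f0
count≡0⇒none (suc k) f c≡0 (suc x) (s<s x<k) | false = count≡0⇒none k (f ∘ suc) c≡0 x x<k

count≡1⇒unique : ∀ k f → count k f ≡ 1 →
  Σ ℕ λ a → a < k × f a ≡ true × (∀ x → x < k → f x ≡ true → x ≡ a)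
count≡1⇒unique (suc k) f c≡1 with f 0 in f0
... | true  = 0 , z<s , f0 , only-0
  where
  only-0 : ∀ x → x < suc k → f x ≡ true → x ≡ 0
  only-0 zero    _         _  = refl
  only-0 (suc x) (s<s x<k) fx with () ← trans (sym fx) (count≡0⇒none k (f ∘ suc) (suc-injective c≡1) x x<k)
... | false with count≡1⇒unique k (f ∘ suc) c≡1
...   | a , a<k , fa , only-a = suc a , s<s a<k , fa , only-suc-a
  where
  only-suc-a : ∀ x → x < suc k → f x ≡ true → x ≡ suc a
  only-suc-a zero    _         fx with () ← trans (sym fx) f0
  only-suc-a (suc x) (s<s x<k) fx = cong suc (only-a x x<k fx)

count≡2⇒pair : ∀ k f → count k f ≡ 2 →
  Σ ℕ λ a → Σ ℕ λ b → a < k × b < k × a ≢ b × f a ≡ true × f b ≡ true ×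
    (∀ x → x < k → f x ≡ true → x ≡ a ⊎ x ≡ b)
count≡2⇒pair (suc k) f c≡2 with f 0 in f0
... | true with count≡1⇒unique k (f ∘ suc) (suc-injective c≡2)
...   | b , b<k , fb , only-b = 0 , suc b , z<s , s<s b<k , (λ ()) , f0 , fb , only-0-or-suc-b
  where
  only-0-or-suc-b : ∀ x → x < suc k → f x ≡ true → x ≡ 0 ⊎ x ≡ suc b
  only-0-or-suc-b zero    _         _  = inj₁ refl
  only-0-or-suc-b (suc x) (s<s x<k) fx = inj₂ (cong suc (only-b x x<k fx))
count≡2⇒pair (suc k) f c≡2 | false with count≡2⇒pair k (f ∘ suc) c≡2
...   | a , b , a<k , b<k , a≢b , fa , fb , only-a-or-b =
  suc a , suc b , s<s a<k , s<s b<k , a≢b ∘ suc-injective , fa , fb , only-suc-a-or-suc-b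
  where
  only-suc-a-or-suc-b : ∀ x → x < suc k → f x ≡ true → x ≡ suc a ⊎ x ≡ suc b
  only-suc-a-or-suc-b zero    _         fx with () ← trans (sym fx) f0
  only-suc-a-or-suc-b (suc x) (s<s x<k) fx = Sum.map (cong suc) (cong suc) (only-a-or-b x x<k fx)

module _ {P : ℕ → Set} (P? : Decidable P) where

  least : ∀ {b} → P b → Σ ℕ λ q → P q × (∀ r → r < q → ¬ P r)
  least {b} = <-rec (λ b → P b → Σ ℕ λ q → P q × (∀ r → r < q → ¬ P r)) step b
    where
    step : ∀ b → (∀ {c} → c < b → P c → Σ ℕ λ q → P q × (∀ r → r < q → ¬ P r)) →
           P b → Σ ℕ λ q → P q × (∀ r → r < q → ¬ P r)
    step b smaller Pb with anyUpTo? P? b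
    ... | yes (c , c<b , Pc) = smaller c<b Pc
    ... | no  none           = b , Pb , λ r r<b Pr → none (r , r<b , Pr)

-- Isomorphisms and wreath products with edgeless graphs

≅-sym : ∀ {G H} → G ≅ H → H ≅ G
≅-sym {G} {H} G≅H = record
  { bij       = ↔-sym bij
  ; preserves = λ u v → trans (sym (preserves (from u) (from v)))
                              (cong₂ (Adj H) (strictlyInverseˡ u) (strictlyInverseˡ v))
  }
  where open _≅_ G≅H; open Inverse bij

≅-trans : ∀ {G H K} → G ≅ H → H ≅ K → G ≅ K
≅-trans G≅H H≅K = record
  { bij       = ↔-trans (_≅_.bij G≅H) (_≅_.bij H≅K)
  ; preserves = λ u v → trans (_≅_.preserves H≅K _ _) (_≅_.preserves G≅H u v)
  }

walk-invariant : ∀ {G} (R : Fin (N G) → Set) → (∀ {x y} → R x → Adj G x y ≡ true → R y) →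
                 ∀ {x y} → Walk G x y → R x → R y
walk-invariant R step []          Rx = Rx
walk-invariant R step (x~v ∷ vw)  Rx = walk-invariant R step vw (step Rx x~v)

≀Empty-adj : ∀ Y m (i j : Fin (N Y * m)) →
  Adj (Y ≀ Empty m) i j ≡ Adj Y (proj₁ (remQuot {N Y} m i)) (proj₁ (remQuot {N Y} m j))
≀Empty-adj Y m i j = trans (cong (a ∨_) (∧-zeroʳ _)) (∨-identityʳ a)
  where a = Adj Y (proj₁ (remQuot {N Y} m i)) (proj₁ (remQuot {N Y} m j))

≅-≀Empty : ∀ G Y m (φ : Fin (N G) ↔ (Fin (N Y) × Fin m)) →
  (∀ u v → Adj Y (proj₁ (Inverse.to φ u)) (proj₁ (Inverse.to φ v)) ≡ Adj G u v) → G ≅ Y ≀ Empty m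
≅-≀Empty G Y m φ adj = record
  { bij       = ↔-trans φ (↔-sym (*↔× {N Y} {m}))
  ; preserves = λ u v → trans (≀Empty-adj Y m _ _)
      (trans (cong₂ (λ p q → Adj Y (proj₁ p) (proj₁ q)) (remQuot-combine _ _) (remQuot-combine _ _)) (adj u v))
  }

≀Empty-congˡ : ∀ {X X'} m → X ≅ X' → X ≀ Empty m ≅ X' ≀ Empty m
≀Empty-congˡ {X} {X'} m X≅X' =
  ≅-≀Empty (X ≀ Empty m) X' m (↔-trans (*↔× {N X} {m}) (_≅_.bij X≅X' ×-↔ ↔-refl))
    (λ u v → trans (_≅_.preserves X≅X' _ _) (sym (≀Empty-adj X m u v)))

⊎↔Fin2× : ∀ {A : Set} → (A ⊎ A) ↔ (Fin 2 × A)
⊎↔Fin2× {A} = mk↔ₛ′ to from to∘from from∘to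
  where
  to : A ⊎ A → Fin 2 × A
  to (inj₁ a) = 0F , a
  to (inj₂ a) = 1F , a
  from : Fin 2 × A → A ⊎ A
  from (0F , a) = inj₁ a
  from (1F , a) = inj₂ a
  to∘from : ∀ p → to (from p) ≡ p
  to∘from (0F , a) = refl
  to∘from (1F , a) = refl
  from∘to : ∀ s → from (to s) ≡ s
  from∘to (inj₁ a) = refl
  from∘to (inj₂ a) = refl

m+n<ᵇm≡false : ∀ m n → (m + n <ᵇ m) ≡ false
m+n<ᵇm≡false zero    n = refl
m+n<ᵇm≡false (suc m) n = m+n<ᵇm≡false m n

K[m,m]≅K[1,1]≀Empty : ∀ m → CompleteBipartite m m ≅ CompleteBipartite 1 1 ≀ Empty m
K[m,m]≅K[1,1]≀Empty m = ≅-≀Empty (CompleteBipartite m m) (CompleteBipartite 1 1) m φ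
  (λ u v → cong₂ _xor_ (side u) (side v))
  where
  φ : Fin (m + m) ↔ (Fin 2 × Fin m)
  φ = ↔-trans (+↔⊎ {m} {m}) ⊎↔Fin2×
  side : ∀ u → (toℕ (proj₁ (Inverse.to φ u)) <ᵇ 1) ≡ (toℕ u <ᵇ m)
  side u with splitAt m u in eq
  ... | inj₁ i = sym (Equivalence.to T-≡ (<⇒<ᵇ u<m))
    where
    u<m : toℕ u < m
    u<m = subst (_< m) (trans (sym (toℕ-↑ˡ i m)) (cong toℕ (splitAt⁻¹-↑ˡ eq))) (toℕ<n i)
  ... | inj₂ j = sym (begin
    toℕ u <ᵇ m            ≡⟨ cong (λ w → toℕ w <ᵇ m) (splitAt⁻¹-↑ʳ eq) ⟨
    toℕ (m ↑ʳ j) <ᵇ m     ≡⟨ cong (_<ᵇ m) (toℕ-↑ʳ m j) ⟩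
    m + toℕ j <ᵇ m        ≡⟨ m+n<ᵇm≡false m (toℕ j) ⟩
    false                 ∎)
    where open ≡-Reasoning

-- Circulant graphs

module Circulant (n : ℕ) .{{_ : NonZero n}} (S : Subset n) where

  open Congruence n

  -- Adj (Cay n S) u v reduces to inS (n + toℕ v ∸ toℕ u)
  inS : ℕ → Bool
  inS x = lookup S (x mod n)

  toℕ-mod≈ : ∀ x → toℕ (x mod n) ≈ x
  toℕ-mod≈ x = trans (cong (_% n) (toℕ-fromℕ< _)) (%-≈ x)

  inS-resp : ∀ {x y} → x ≈ y → inS x ≡ inS y
  inS-resp x≈y = cong (lookup S) (toℕ-injective (trans (toℕ-fromℕ< _) (trans x≈y (sym (toℕ-fromℕ< _)))))

  inS-periodic : IsPeriod inS n
  inS-periodic x = inS-resp (+k≈ x)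

  Cay-regular : Regular (Cay n S) (count n inS)
  Cay-regular v = begin
    degree (Cay n S) v                      ≡⟨ ∣tabulate∣≡count n (λ x → inS (n + x ∸ toℕ v)) ⟩
    count n (λ x → inS (n + x ∸ toℕ v))     ≡⟨ count-cong n (λ x _ → cong inS n+x∸v≡x+[n∸v]) ⟩
    count n (λ x → inS (x + (n ∸ toℕ v)))   ≡⟨ PeriodicCount.count-shift n inS inS-periodic (n ∸ toℕ v) ⟩
    count n inS                             ∎
    where
    open ≡-Reasoning
    n+x∸v≡x+[n∸v] : ∀ {x} → n + x ∸ toℕ v ≡ x + (n ∸ toℕ v)
    n+x∸v≡x+[n∸v] {x} = trans (cong (_∸ toℕ v) (+-comm n x)) (+-∸-assoc x (<⇒≤ (toℕ<n v)))

  twins⇒period : ∀ {v w} → Twins (Cay n S) v w → IsPeriod inS (n + toℕ w ∸ toℕ v)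
  twins⇒period {v} {w} (_ , same-nbrs) x = begin
    inS (x + h)          ≡⟨ inS-resp (+-≈⇒≈-∸ (toℕ<n v) x+h+V≈u) ⟩
    inS (n + toℕ u ∸ V)  ≡⟨ same-nbrs u ⟩
    inS (n + toℕ u ∸ W)  ≡⟨ inS-resp (+-≈⇒≈-∸ (toℕ<n w) x+W≈u) ⟨
    inS x                ∎
    where
    open ≡-Reasoning
    V = toℕ v
    W = toℕ w
    h = n + W ∸ V
    u = (x + W) mod n
    x+W≈u : x + W ≈ toℕ u
    x+W≈u = sym (toℕ-mod≈ (x + W))
    x+h+V≈u : x + h + V ≈ toℕ u
    x+h+V≈u = trans (cong (_% n) (+-assoc x h V)) (trans (+-congˡ x (k+a∸b+b≈a W V (toℕ<n v))) x+W≈u)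

  positive-period? : Decidable (λ p → 0 < p × IsPeriod inS p)
  positive-period? p = (0 <? p) ×-dec
    map′ period-on-Fin (λ per i → per (toℕ i)) (all? λ i → inS (toℕ i + p) ≟ᵇ inS (toℕ i))
    where
    period-on-Fin : (∀ (i : Fin n) → inS (toℕ i + p) ≡ inS (toℕ i)) → IsPeriod inS p
    period-on-Fin per x = begin
      inS (x + p)              ≡⟨ inS-resp (+-congʳ p (sym (toℕ-mod≈ x))) ⟩
      inS (toℕ (x mod n) + p)  ≡⟨ per (x mod n) ⟩
      inS (toℕ (x mod n))      ≡⟨ inS-resp (toℕ-mod≈ x) ⟩
      inS x                    ∎
      where open ≡-Reasoning

  connected-induction : Connected (Cay n S) → (R : ℕ → Set) → (∀ {x y} → x ≈ y → R x → R y) →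
              R 0 → (∀ {x s} → R x → inS s ≡ true → R (s + x)) → ∀ v → R (toℕ v)
  connected-induction conn R R-resp R0 R-step v =
    walk-invariant (R ∘ toℕ) step (conn (0ₙ n) v) (R-resp (sym (toℕ-mod≈ 0)) R0)
    where
    step : ∀ {x y} → R (toℕ x) → Adj (Cay n S) x y ≡ true → R (toℕ y)
    step {x} {y} Rx x~y = R-resp (k+a∸b+b≈a (toℕ y) (toℕ x) (toℕ<n x)) (R-step Rx x~y)

  inS-toℕ : ∀ a → inS (toℕ a) ≡ lookup S a
  inS-toℕ a = cong (lookup S) (toℕ-injective (trans (toℕ-fromℕ< _) (m<n⇒m%n≡m (toℕ<n a))))

  connectionSet : inS 0 ≡ false → (∀ x → x < n → inS x ≡ true → inS (n ∸ x) ≡ true) → ConnectionSet n S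
  connectionSet inS-0 inS-neg = 0∉S , neg∈S
    where
    0∉S : 0ₙ n ∉ S
    0∉S 0∈S with () ← trans (sym inS-0) ([]=⇒lookup 0∈S)
    neg∈S : ∀ a → a ∈ S → negₙ n a ∈ S
    neg∈S a a∈S = lookup⇒[]= _ S (inS-neg (toℕ a) (toℕ<n a) (trans (inS-toℕ a) ([]=⇒lookup a∈S)))

  module _ (cs : ConnectionSet n S) where

    inS-0 : inS 0 ≡ false
    inS-0 with inS 0 in eq
    ... | true  = ⊥-elim (proj₁ cs (lookup⇒[]= (0 mod n) S eq))
    ... | false = refl

    inS-neg : ∀ x → x < n → inS x ≡ true → inS (n ∸ x) ≡ true
    inS-neg x x<n x∈S = subst (λ z → inS (n ∸ z) ≡ true) (trans (toℕ-fromℕ< _) (m<n⇒m%n≡m x<n))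
                          ([]=⇒lookup (proj₂ cs (x mod n) (lookup⇒[]= (x mod n) S x∈S)))

-- Connected circulants of valency one and two

K₂-circulant : ∀ k .{{_ : NonZero k}} (T : Subset k) → k ≡ 2 →
  Circulant.inS k T 0 ≡ false → Circulant.inS k T 1 ≡ true → Cay k T ≅ CompleteBipartite 1 1
K₂-circulant .2 (false ∷ true ∷ []) refl refl refl = record { bij = ↔-refl ; preserves = adj }
  where
  adj : ∀ u v → Adj (CompleteBipartite 1 1) u v ≡ Adj (Cay 2 (false ∷ true ∷ [])) u v
  adj 0F 0F = refl
  adj 0F 1F = refl
  adj 1F 0F = refl
  adj 1F 1F = refl

module ValencyOne (k : ℕ) .{{_ : NonZero k}} (T : Subset k) (cs : ConnectionSet k T) (conn : Connected (Cay k T))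
  (a : ℕ) (a<k : a < k) (a∈T : Circulant.inS k T a ≡ true)
  (only-a : ∀ x → x < k → Circulant.inS k T x ≡ true → x ≡ a) where

  open Circulant k T
  open Congruence k

  ∈T⇒≈a : ∀ {x} → inS x ≡ true → x ≈ a
  ∈T⇒≈a {x} x∈T = trans (only-a (x % k) (m%n<n x k) (trans (Periodic.f[x%k]≡f[x] inS inS-periodic x) x∈T))
                         (sym (m<n⇒m%n≡m a<k))

  a≢0 : a ≢ 0
  a≢0 refl with () ← trans (sym a∈T) (inS-0 cs)

  2≤k : 2 ≤ k
  2≤k = ≤-trans (s≤s (n≢0⇒n>0 a≢0)) a<k

  a+a≈0 : a + a ≈ 0
  a+a≈0 = begin
    (a + a) % k         ≡⟨ +-congʳ a (∈T⇒≈a (inS-neg cs a a<k a∈T)) ⟨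
    (k ∸ a + a) % k     ≡⟨ cong (_% k) (m∸n+n≡m (<⇒≤ a<k)) ⟩
    k % k               ≡⟨ k≈0 ⟩
    0 % k               ∎
    where open ≡-Reasoning

  0-or-a : ∀ (v : Fin k) → toℕ v ≈ 0 ⊎ toℕ v ≈ a
  0-or-a = connected-induction conn (λ x → x ≈ 0 ⊎ x ≈ a) respects (inj₁ refl) step
    where
    respects : ∀ {x y} → x ≈ y → x ≈ 0 ⊎ x ≈ a → y ≈ 0 ⊎ y ≈ a
    respects x≈y (inj₁ x≈0) = inj₁ (trans (sym x≈y) x≈0)
    respects x≈y (inj₂ x≈a) = inj₂ (trans (sym x≈y) x≈a)
    step : ∀ {x s} → x ≈ 0 ⊎ x ≈ a → inS s ≡ true → s + x ≈ 0 ⊎ s + x ≈ a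
    step (inj₁ x≈0) s∈T = inj₂ (trans (+-cong (∈T⇒≈a s∈T) x≈0) (cong (_% k) (+-identityʳ a)))
    step (inj₂ x≈a) s∈T = inj₁ (trans (+-cong (∈T⇒≈a s∈T) x≈a) a+a≈0)

  a≡1 : a ≡ 1
  a≡1 with 0-or-a (fromℕ< 2≤k)
  ... | inj₁ 1≈0 with () ← ≈⇒≡ 2≤k (>-nonZero⁻¹ k) (trans (cong (_% k) (sym (toℕ-fromℕ< 2≤k))) 1≈0)
  ... | inj₂ 1≈a = sym (≈⇒≡ 2≤k a<k (trans (cong (_% k) (sym (toℕ-fromℕ< 2≤k))) 1≈a))

  k≡2 : k ≡ 2
  k≡2 with k ≤? 2
  ... | yes k≤2 = ≤-antisym k≤2 2≤k
  ... | no  k≰2 with () ← ≈⇒≡ (≰⇒> k≰2) (>-nonZero⁻¹ k) (subst (λ z → z + z ≈ 0) a≡1 a+a≈0)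

valency-one-circulant : ∀ k .{{_ : NonZero k}} (T : Subset k) → ConnectionSet k T → Connected (Cay k T) →
  count k (Circulant.inS k T) ≡ 1 → Cay k T ≅ CompleteBipartite 1 1
valency-one-circulant k T cs conn valency-1 with count≡1⇒unique k (Circulant.inS k T) valency-1
... | a , a<k , a∈T , only-a =
  K₂-circulant k T k≡2 (Circulant.inS-0 k T cs) (subst (λ z → Circulant.inS k T z ≡ true) a≡1 a∈T)
  where open ValencyOne k T cs conn a a<k a∈T only-a

T-⇔⇒≡ : ∀ {x y} → Bool.T x ⇔ Bool.T y → x ≡ y
T-⇔⇒≡ {false} {false} _   = refl
T-⇔⇒≡ {false} {true}  x⇔y with () ← Equivalence.from x⇔y _
T-⇔⇒≡ {true}  {false} x⇔y with () ← Equivalence.to x⇔y _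
T-⇔⇒≡ {true}  {true}  _   = refl

module _ (k : ℕ) .{{_ : NonZero k}} where

  open Congruence k

  succAdj⇔ : ∀ {i j} → i < k → j < k → Bool.T (succAdj k i j) ⇔ j ≈ suc i
  succAdj⇔ {i} {j} i<k j<k = mk⇔ to from
    where
    to : Bool.T (succAdj k i j) → j ≈ suc i
    to t with Equivalence.to T-∨ t
    ... | inj₁ j≡1+i = cong (_% k) (≡ᵇ⇒≡ j (suc i) j≡1+i)
    ... | inj₂ t′ with Equivalence.to (T-∧ {suc i ≡ᵇ k}) t′
    ...   | 1+i≡k , j≡0 rewrite ≡ᵇ⇒≡ j 0 j≡0 | ≡ᵇ⇒≡ (suc i) k 1+i≡k = sym k≈0
    from : j ≈ suc i → Bool.T (succAdj k i j)
    from j≈1+i with m≤n⇒m<n∨m≡n i<k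
    ... | inj₁ 1+i<k = Equivalence.from T-∨ (inj₁ (≡⇒≡ᵇ j (suc i) (≈⇒≡ j<k 1+i<k j≈1+i)))
    ... | inj₂ 1+i≡k = Equivalence.from (T-∨ {j ≡ᵇ suc i}) (inj₂ (Equivalence.from T-∧
            (≡⇒≡ᵇ (suc i) k 1+i≡k , ≡⇒≡ᵇ j 0 (≈⇒≡ j<k (>-nonZero⁻¹ k) j≈0))))
      where
      j≈0 : j ≈ 0
      j≈0 = trans j≈1+i (trans (cong (_% k) 1+i≡k) k≈0)

  Cycle-adj⇔ : ∀ (i j : Fin k) → Bool.T (Adj (Cycle k) i j) ⇔ (toℕ j ≈ suc (toℕ i) ⊎ toℕ i ≈ suc (toℕ j))
  Cycle-adj⇔ i j = (succAdj⇔ (toℕ<n i) (toℕ<n j) ⊎-⇔ succAdj⇔ (toℕ<n j) (toℕ<n i)) ⇔-∘ T-∨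

module ValencyTwo (k : ℕ) .{{_ : NonZero k}} (T : Subset k) (cs : ConnectionSet k T) (conn : Connected (Cay k T))
  (a b : ℕ) (a<k : a < k) (b<k : b < k) (a≢b : a ≢ b)
  (a∈T : Circulant.inS k T a ≡ true) (b∈T : Circulant.inS k T b ≡ true)
  (only-a-b : ∀ x → x < k → Circulant.inS k T x ≡ true → x ≡ a ⊎ x ≡ b) where

  open Circulant k T
  open Congruence k
  open Periodic inS inS-periodic using (≈⇒f≡; f[x%k]≡f[x])

  ∈T⇒≈a⊎≈b : ∀ {x} → inS x ≡ true → x ≈ a ⊎ x ≈ b
  ∈T⇒≈a⊎≈b {x} x∈T = Sum.map (λ e → trans e (sym (m<n⇒m%n≡m a<k))) (λ e → trans e (sym (m<n⇒m%n≡m b<k)))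
    (only-a-b (x % k) (m%n<n x k) (trans (f[x%k]≡f[x] x) x∈T))

  nonzero : ∀ {x} → inS x ≡ true → x ≢ 0
  nonzero x∈T refl with () ← trans (sym x∈T) (inS-0 cs)

  3≤k : 3 ≤ k
  3≤k with k ≤? 2
  ... | no  k≰2 = ≰⇒> k≰2
  ... | yes k≤2 = ⊥-elim (a≢b (trans (is-1 a<k (nonzero a∈T)) (sym (is-1 b<k (nonzero b∈T)))))
    where
    is-1 : ∀ {x} → x < k → x ≢ 0 → x ≡ 1
    is-1 x<k x≢0 = ≤-antisym (s≤s⁻¹ (≤-trans x<k k≤2)) (n≢0⇒n>0 x≢0)

  k∸x<k : ∀ {x} → x < k → inS x ≡ true → k ∸ x < k
  k∸x<k x<k x∈T = ∸-monoʳ-< (n≢0⇒n>0 (nonzero x∈T)) (<⇒≤ x<k)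

  a+b≡k : a + b ≡ k
  a+b≡k with only-a-b (k ∸ a) (k∸x<k a<k a∈T) (inS-neg cs a a<k a∈T)
  ... | inj₂ k∸a≡b = trans (cong (a +_) (sym k∸a≡b)) (m+[n∸m]≡n (<⇒≤ a<k))
  ... | inj₁ k∸a≡a with only-a-b (k ∸ b) (k∸x<k b<k b∈T) (inS-neg cs b b<k b∈T)
  ...   | inj₁ k∸b≡a =
    ⊥-elim (a≢b (trans (sym k∸a≡a) (trans (cong (k ∸_) (sym k∸b≡a)) (m∸[m∸n]≡n (<⇒≤ b<k)))))
  ...   | inj₂ k∸b≡b = ⊥-elim (a≢b (double-injective (trans (twice k∸a≡a a<k) (sym (twice k∸b≡b b<k)))))
    where
    twice : ∀ {x} → k ∸ x ≡ x → x < k → x + x ≡ k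
    twice {x} k∸x≡x x<k = trans (cong (x +_) (sym k∸x≡x)) (m+[n∸m]≡n (<⇒≤ x<k))
    double-injective : ∀ {x y} → x + x ≡ y + y → x ≡ y
    double-injective {x} {y} e =
      *-cancelˡ-≡ x y 2 (trans (cong (x +_) (+-identityʳ x)) (trans e (cong (y +_) (sym (+-identityʳ y)))))

  b≈[k-1]*a : b ≈ pred k * a
  b≈[k-1]*a = +-cancelʳ a (begin
    (b + a) % k              ≡⟨ cong (_% k) (trans (+-comm b a) a+b≡k) ⟩
    k % k                    ≡⟨ k≈0 ⟩
    0 % k                    ≡⟨ +*k≈ 0 a ⟨
    (a * k) % k              ≡⟨ cong (λ z → (a * z) % k) (suc-pred k) ⟨
    (a * suc (pred k)) % k   ≡⟨ cong (_% k) (trans (*-suc a (pred k)) (+-comm a (a * pred k))) ⟩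
    (a * pred k + a) % k     ≡⟨ cong (λ z → (z + a) % k) (*-comm a (pred k)) ⟩
    (pred k * a + a) % k     ∎)
    where open ≡-Reasoning

  multiple-of-a : ∀ (v : Fin k) → Σ ℕ λ j → toℕ v ≈ j * a
  multiple-of-a = connected-induction conn (λ x → Σ ℕ λ j → x ≈ j * a)
                    (λ x≈y (j , x≈ja) → j , trans (sym x≈y) x≈ja) (0 , refl) step
    where
    step : ∀ {x s} → (Σ ℕ λ j → x ≈ j * a) → inS s ≡ true → Σ ℕ λ j → s + x ≈ j * a
    step (j , x≈ja) s∈T with ∈T⇒≈a⊎≈b s∈T
    ... | inj₁ s≈a = suc j , +-cong s≈a x≈ja
    ... | inj₂ s≈b = pred k + j ,
      trans (+-cong (trans s≈b b≈[k-1]*a) x≈ja) (cong (_% k) (sym (*-distribʳ-+ a (pred k) j)))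

  a-invertible : Σ ℕ λ a⁻¹ → a⁻¹ * a ≈ 1
  a-invertible with multiple-of-a (fromℕ< {1} (≤-trans (s≤s (s≤s z≤n)) 3≤k))
  ... | j , 1≈ja = j , trans (sym 1≈ja) (cong (_% k) (toℕ-fromℕ< _))

  a⁻¹ : ℕ
  a⁻¹ = proj₁ a-invertible

  *a⁻¹*a≈ : ∀ x → x * a⁻¹ * a ≈ x
  *a⁻¹*a≈ x =
    trans (cong (_% k) (*-assoc x a⁻¹ a)) (trans (*-congˡ x (proj₂ a-invertible)) (cong (_% k) (*-identityʳ x)))

  *a*a⁻¹≈ : ∀ x → x * a * a⁻¹ ≈ x
  *a*a⁻¹≈ x = trans (cong (_% k) x*a*a⁻¹≡x*a⁻¹*a) (*a⁻¹*a≈ x)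
    where
    x*a*a⁻¹≡x*a⁻¹*a : x * a * a⁻¹ ≡ x * a⁻¹ * a
    x*a*a⁻¹≡x*a⁻¹*a = trans (*-assoc x a a⁻¹) (trans (cong (x *_) (*-comm a a⁻¹)) (sym (*-assoc x a⁻¹ a)))

  ≈a+⇔*a⁻¹≈1+ : ∀ x y → x ≈ a + y ⇔ x * a⁻¹ ≈ suc (y * a⁻¹)
  ≈a+⇔*a⁻¹≈1+ x y = mk⇔ to from
    where
    open ≡-Reasoning
    to : x ≈ a + y → x * a⁻¹ ≈ suc (y * a⁻¹)
    to x≈a+y = begin
      (x * a⁻¹) % k             ≡⟨ *-congʳ a⁻¹ x≈a+y ⟩
      ((a + y) * a⁻¹) % k       ≡⟨ cong (_% k) (*-distribʳ-+ a⁻¹ a y) ⟩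
      (a * a⁻¹ + y * a⁻¹) % k   ≡⟨ +-congʳ (y * a⁻¹) (trans (cong (_% k) (*-comm a a⁻¹)) (proj₂ a-invertible)) ⟩
      (1 + y * a⁻¹) % k         ∎
    from : x * a⁻¹ ≈ suc (y * a⁻¹) → x ≈ a + y
    from xJ≈1+yJ = begin
      x % k                   ≡⟨ *a⁻¹*a≈ x ⟨
      (x * a⁻¹ * a) % k         ≡⟨ *-congʳ a xJ≈1+yJ ⟩
      ((1 + y * a⁻¹) * a) % k   ≡⟨ cong (_% k) (*-distribʳ-+ a 1 (y * a⁻¹)) ⟩
      (1 * a + y * a⁻¹ * a) % k ≡⟨ +-congˡ (1 * a) (*a⁻¹*a≈ y) ⟩
      (1 * a + y) % k         ≡⟨ cong (λ z → (z + y) % k) (*-identityˡ a) ⟩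
      (a + y) % k             ∎

  Cay-adj⇔ : ∀ (u v : Fin k) → inS (k + toℕ v ∸ toℕ u) ≡ true ⇔ (toℕ v ≈ a + toℕ u ⊎ toℕ u ≈ a + toℕ v)
  Cay-adj⇔ u v = mk⇔ (λ d∈T → Sum.map d≈a⇒ d≈b⇒ (∈T⇒≈a⊎≈b d∈T))
                      [ (λ e → trans (≈⇒f≡ (⇒d≈a e)) a∈T) , (λ e → trans (≈⇒f≡ (⇒d≈b e)) b∈T) ]′
    where
    open ≡-Reasoning
    U = toℕ u
    V = toℕ v
    d = k + V ∸ U
    d+U≈V : d + U ≈ V
    d+U≈V = k+a∸b+b≈a V U (toℕ<n u)
    d≈a⇒ : d ≈ a → V ≈ a + U
    d≈a⇒ d≈a = trans (sym d+U≈V) (+-congʳ U d≈a)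
    ⇒d≈a : V ≈ a + U → d ≈ a
    ⇒d≈a V≈a+U = +-cancelʳ U (trans d+U≈V V≈a+U)
    k+x≈x : ∀ x → k + x ≈ x
    k+x≈x x = trans (cong (_% k) (+-comm k x)) (+k≈ x)
    a+[b+x]≈x : ∀ x → a + (b + x) ≈ x
    a+[b+x]≈x x = trans (cong (_% k) (trans (sym (+-assoc a b x)) (cong (_+ x) a+b≡k))) (k+x≈x x)
    b+[a+x]≈x : ∀ x → b + (a + x) ≈ x
    b+[a+x]≈x x =
      trans (cong (_% k) (trans (sym (+-assoc b a x)) (cong (_+ x) (trans (+-comm b a) a+b≡k)))) (k+x≈x x)
    d≈b⇒ : d ≈ b → U ≈ a + V
    d≈b⇒ d≈b = sym (trans (+-congˡ a (trans (sym d+U≈V) (+-congʳ U d≈b))) (a+[b+x]≈x U))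
    ⇒d≈b : U ≈ a + V → d ≈ b
    ⇒d≈b U≈a+V = +-cancelʳ U (trans d+U≈V (sym (trans (+-congˡ b U≈a+V) (b+[a+x]≈x V))))

  ψ : Fin k → Fin k
  ψ u = (toℕ u * a⁻¹) mod k

  ψ-shift⇔ : ∀ (u v : Fin k) → toℕ (ψ v) ≈ suc (toℕ (ψ u)) ⇔ toℕ v ≈ a + toℕ u
  ψ-shift⇔ u v = ⇔-sym (≈a+⇔*a⁻¹≈1+ (toℕ v) (toℕ u)) ⇔-∘ mk⇔
    (λ e → trans (sym (toℕ-mod≈ _)) (trans e (+-congˡ 1 (toℕ-mod≈ _))))
    (λ e → trans (toℕ-mod≈ _) (trans e (sym (+-congˡ 1 (toℕ-mod≈ _)))))

  Cay≅Cycle : Cay k T ≅ Cycle k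
  Cay≅Cycle = record { bij = mk↔ₛ′ ψ ψ⁻¹ ψ∘ψ⁻¹ ψ⁻¹∘ψ ; preserves = adj }
    where
    ψ⁻¹ : Fin k → Fin k
    ψ⁻¹ x = (toℕ x * a) mod k
    ψ∘ψ⁻¹ : ∀ x → ψ (ψ⁻¹ x) ≡ x
    ψ∘ψ⁻¹ x = toℕ-injective (≈⇒≡ (toℕ<n _) (toℕ<n x)
                (trans (toℕ-mod≈ _) (trans (*-congʳ a⁻¹ (toℕ-mod≈ _)) (*a*a⁻¹≈ (toℕ x)))))
    ψ⁻¹∘ψ : ∀ u → ψ⁻¹ (ψ u) ≡ u
    ψ⁻¹∘ψ u = toℕ-injective (≈⇒≡ (toℕ<n _) (toℕ<n u)
                (trans (toℕ-mod≈ _) (trans (*-congʳ a (toℕ-mod≈ _)) (*a⁻¹*a≈ (toℕ u)))))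
    adj : ∀ u v → Adj (Cycle k) (ψ u) (ψ v) ≡ Adj (Cay k T) u v
    adj u v = T-⇔⇒≡ (⇔-sym T-≡ ⇔-∘ (⇔-sym (Cay-adj⇔ u v) ⇔-∘
                       ((ψ-shift⇔ u v ⊎-⇔ ψ-shift⇔ v u) ⇔-∘ Cycle-adj⇔ k (ψ u) (ψ v))))

valency-two-circulant : ∀ k .{{_ : NonZero k}} (T : Subset k) → ConnectionSet k T → Connected (Cay k T) →
  count k (Circulant.inS k T) ≡ 2 → 3 ≤ k × Cay k T ≅ Cycle k
valency-two-circulant k T cs conn valency-2 with count≡2⇒pair k (Circulant.inS k T) valency-2
... | a , b , a<k , b<k , a≢b , a∈T , b∈T , only-a-b = 3≤k , Cay≅Cycle
  where open ValencyTwo k T cs conn a b a<k b<k a≢b a∈T b∈T only-a-b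

Prime[m*n]⇒m≡1 : ∀ m n → 2 ≤ n → Prime (m * n) → m ≡ 1
Prime[m*n]⇒m≡1 0             n _   p = ⊥-elim (NonTrivial.nonTrivial (prime⇒nonTrivial p))
Prime[m*n]⇒m≡1 1             n _   p = refl
Prime[m*n]⇒m≡1 (suc (suc m)) n 2≤n p = ⊥-elim (prime⇒¬composite p
  (hasNonTrivialDivisor {{n>1⇒nonTrivial 2≤n}} n<[2+m]*n (n∣m*n (suc (suc m)))))
  where
  instance _ = >-nonZero (≤-trans (s≤s z≤n) 2≤n)
  n<[2+m]*n : n < suc (suc m) * n
  n<[2+m]*n = subst (n <_) (*-comm n (suc (suc m))) (m<m*n n (suc (suc m)) (s≤s (s≤s z≤n)))

m*n≡4⇒ : ∀ m n → 2 ≤ n → m * n ≡ 4 → (m ≡ 1 × n ≡ 4) ⊎ (m ≡ 2 × n ≡ 2)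
m*n≡4⇒ 1 n _ m*n≡4 = inj₁ (refl , trans (sym (+-identityʳ n)) m*n≡4)
m*n≡4⇒ 2 n 2≤n m*n≡4 = inj₂ (refl , *-cancelˡ-≡ n 2 2 m*n≡4)
m*n≡4⇒ 0 n _ ()
m*n≡4⇒ (suc (suc (suc m))) n 2≤n m*n≡4
  with s≤s (s≤s (s≤s (s≤s ()))) ← subst (6 ≤_) m*n≡4 (*-mono-≤ (m≤m+n 3 m) 2≤n)

-- Quotient of a circulant graph by the least period of its connection set

cast-↔ : ∀ {m n} → m ≡ n → Fin m ↔ Fin n
cast-↔ eq = mk↔ₛ′ (cast eq) (cast (sym eq)) (cast-involutive eq (sym eq)) (cast-involutive (sym eq) eq)

toℕ-remQuot₂ : ∀ {m} k .{{_ : NonZero k}} (i : Fin (m * k)) → toℕ (proj₂ (remQuot {m} k i)) ≡ toℕ i % k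
toℕ-remQuot₂ {m} k i = begin
  r                            ≡⟨ m<n⇒m%n≡m (toℕ<n (proj₂ (remQuot {m} k i))) ⟨
  r % k                        ≡⟨ [m+kn]%n≡m%n r q k ⟨
  (r + q * k) % k              ≡⟨ cong (_% k) (trans (+-comm r (q * k)) (cong (_+ r) (*-comm q k))) ⟩
  (k * q + r) % k              ≡⟨ cong (_% k) (toℕ-combine (proj₁ (remQuot {m} k i)) _) ⟨
  toℕ (uncurry combine (remQuot {m} k i)) % k ≡⟨ cong (λ j → toℕ j % k) (combine-remQuot {m} k i) ⟩
  toℕ i % k                    ∎
  where
  open ≡-Reasoning
  q = toℕ (proj₁ (remQuot {m} k i))
  r = toℕ (proj₂ (remQuot {m} k i))

module LeastPeriod (n : ℕ) .{{_ : NonZero n}} (S : Subset n) (k : ℕ) .{{_ : NonZero k}}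
  (k-period : IsPeriod (Circulant.inS n S) k)
  (k-least : ∀ r → r < k → ¬ (0 < r × IsPeriod (Circulant.inS n S) r)) where

  open Circulant n S
  open Congruence k
  open Periodic inS k-period using (≈⇒f≡)

  X : Graph
  X = Cay n S

  period%k≡0 : ∀ {p} → IsPeriod inS p → p % k ≡ 0
  period%k≡0 {p} p-period with p % k ≟ 0
  ... | yes r≡0 = r≡0
  ... | no  r≢0 = ⊥-elim (k-least (p % k) (m%n<n p k) (n≢0⇒n>0 r≢0 , r-period))
    where
    r-period : IsPeriod inS (p % k)
    r-period x = begin
      inS (x + p % k)   ≡⟨ ≈⇒f≡ (+-congˡ x (%-≈ p)) ⟩
      inS (x + p)       ≡⟨ p-period x ⟩
      inS x             ∎
      where open ≡-Reasoning

  n≈0 : n ≈ 0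
  n≈0 = trans (period%k≡0 inS-periodic) (sym 0%k≡0)

  n+x∸y+y≈x : ∀ x y → y < n → n + x ∸ y + y ≈ x
  n+x∸y+y≈x x y y<n = trans (cong (_% k) (m∸n+n≡m (≤-trans (<⇒≤ y<n) (m≤m+n n x)))) (+-congʳ x n≈0)

  m : ℕ
  m = n / k

  n≡m*k : n ≡ m * k
  n≡m*k = trans (m≡m%n+[m/n]*n n k) (cong (_+ m * k) (period%k≡0 inS-periodic))

  k≤n : k ≤ n
  k≤n = ≮⇒≥ (λ n<k → k-least n n<k (>-nonZero⁻¹ n , inS-periodic))

  k<n⇒2≤m : k < n → 2 ≤ m
  k<n⇒2≤m k<n = ≰⇒> m≰1
    where
    m≰1 : ¬ m ≤ 1
    m≰1 m≤1 = <⇒≱ k<n (begin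
      n      ≡⟨ n≡m*k ⟩
      m * k  ≤⟨ *-monoˡ-≤ k m≤1 ⟩
      1 * k  ≡⟨ *-identityˡ k ⟩
      k      ∎)
      where open ≤-Reasoning

  twins⇔ : ∀ v w → Twins X v w ⇔ (v ≢ w × toℕ v ≈ toℕ w)
  twins⇔ v w = mk⇔ (λ tw → proj₁ tw , twins⇒≈ tw) (λ (v≢w , v≈w) → v≢w , λ u → same-nbrs u v≈w)
    where
    V = toℕ v
    W = toℕ w
    twins⇒≈ : Twins X v w → V ≈ W
    twins⇒≈ tw = begin
      V % k                  ≡⟨ +-congʳ V (trans 0%k≡0 (sym (period%k≡0 (twins⇒period tw)))) ⟩
      (n + W ∸ V + V) % k    ≡⟨ n+x∸y+y≈x W V (toℕ<n v) ⟩
      W % k                  ∎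
      where open ≡-Reasoning
    same-nbrs : ∀ u → V ≈ W → Adj X v u ≡ Adj X w u
    same-nbrs u V≈W = ≈⇒f≡ (+-cancelʳ V (begin
      (n + U ∸ V + V) % k    ≡⟨ n+x∸y+y≈x U V (toℕ<n v) ⟩
      U % k                  ≡⟨ n+x∸y+y≈x U W (toℕ<n w) ⟨
      (n + U ∸ W + W) % k    ≡⟨ +-congˡ (n + U ∸ W) V≈W ⟨
      (n + U ∸ W + V) % k    ∎))
      where
      open ≡-Reasoning
      U = toℕ u

  T : Subset k
  T = tabulate (inS ∘ toℕ)

  Y : Graph
  Y = Cay k T

  module Y = Circulant k T

  inT≡inS : ∀ x → Y.inS x ≡ inS x
  inT≡inS x = trans (lookup∘tabulate (inS ∘ toℕ) (x mod k))
                (trans (cong inS (toℕ-fromℕ< _)) (Periodic.f[x%k]≡f[x] inS k-period x))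

  adj-quotient : ∀ (a b : Fin k) (u v : Fin n) → toℕ a ≈ toℕ u → toℕ b ≈ toℕ v → Adj Y a b ≡ Adj X u v
  adj-quotient a b u v a≈u b≈v = trans (inT≡inS _) (≈⇒f≡ (+-cancelʳ U (begin
    (k + B ∸ A + U) % k     ≡⟨ +-congˡ (k + B ∸ A) a≈u ⟨
    (k + B ∸ A + A) % k     ≡⟨ k+a∸b+b≈a B A (toℕ<n a) ⟩
    B % k                   ≡⟨ b≈v ⟩
    V % k                   ≡⟨ n+x∸y+y≈x V U (toℕ<n u) ⟨
    (n + V ∸ U + U) % k     ∎)))
    where
    open ≡-Reasoning
    A = toℕ a
    B = toℕ b
    U = toℕ u
    V = toℕ v

  Y-connected : Connected X → Connected Y
  Y-connected conn a b = subst₂ (Walk Y) (π-lift a) (π-lift b) (project (conn (lift a) (lift b)))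
    where
    π : Fin n → Fin k
    π u = toℕ u mod k
    project : ∀ {u v} → Walk X u v → Walk Y (π u) (π v)
    project []                          = []
    project (_∷_ {u} {w} u~w walk) =
      trans (adj-quotient (π u) (π w) u w (Y.toℕ-mod≈ (toℕ u)) (Y.toℕ-mod≈ (toℕ w))) u~w ∷ project walk
    lift : Fin k → Fin n
    lift a = inject≤ a k≤n
    π-lift : ∀ a → π (lift a) ≡ a
    π-lift a =
      toℕ-injective (trans (toℕ-fromℕ< _) (trans (cong (_% k) (toℕ-inject≤ a k≤n)) (m<n⇒m%n≡m (toℕ<n a))))

  Y-connectionSet : ConnectionSet n S → ConnectionSet k T
  Y-connectionSet cs = Y.connectionSet (trans (inT≡inS 0) (inS-0 cs)) inT-neg
    where
    inT-neg : ∀ x → x < k → Y.inS x ≡ true → Y.inS (k ∸ x) ≡ true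
    inT-neg x x<k x∈T = trans (inT≡inS (k ∸ x)) (trans (≈⇒f≡ k∸x≈n∸x)
                          (inS-neg cs x (≤-trans x<k k≤n) (trans (sym (inT≡inS x)) x∈T)))
      where
      k∸x≈n∸x : k ∸ x ≈ n ∸ x
      k∸x≈n∸x = +-cancelʳ x (trans (cong (_% k) (m∸n+n≡m (<⇒≤ x<k)))
                  (trans k≈0 (trans (sym n≈0) (cong (_% k) (sym (m∸n+n≡m (≤-trans (<⇒≤ x<k) k≤n)))))))

  δ : ℕ
  δ = count k inS

  Y-valency : count k Y.inS ≡ δ
  Y-valency = count-cong k (λ x _ → inT≡inS x)

  Y-regular : Regular Y δ
  Y-regular v = trans (Y.Cay-regular v) Y-valency

  X-regular : Regular X (m * δ)
  X-regular v = trans (Cay-regular v) (trans (cong (λ z → count z inS) n≡m*k) (PeriodicCount.count-* k inS k-period m))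

  X≅Y≀Empty : X ≅ Y ≀ Empty m
  X≅Y≀Empty = ≅-≀Empty X Y m (↔-trans (cast-↔ n≡m*k) (↔-trans (*↔× {m} {k}) (×-comm _ _)))
    (λ u v → adj-quotient (residue u) (residue v) u v (residue≈ u) (residue≈ v))
    where
    residue : Fin n → Fin k
    residue u = proj₂ (remQuot {m} k (cast n≡m*k u))
    residue≈ : ∀ u → toℕ (residue u) ≈ toℕ u
    residue≈ u =
      trans (cong (_% k) (trans (toℕ-remQuot₂ {m} k (cast n≡m*k u)) (cong (_% k) (toℕ-cast n≡m*k u)))) (%-≈ (toℕ u))

  ¬TwinFree⇒k<n : ¬ TwinFree X → k < n
  ¬TwinFree⇒k<n not-twin-free = ≤∧≢⇒< k≤n k≢n
    where
    k≢n : k ≢ n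
    k≢n refl = not-twin-free λ (v , w , tw) → proj₁ tw (toℕ-injective
      (≈⇒≡ (toℕ<n v) (toℕ<n w) (proj₂ (Equivalence.to (twins⇔ v w) tw))))

  twins-of-0 : m ≡ 2 → ∀ w → Twins X (0ₙ n) w ⇔ toℕ w ≡ k
  twins-of-0 m≡2 w = mk⇔ (λ tw → twin⇒≡k (Equivalence.to (twins⇔ (0ₙ n) w) tw))
                          (λ W≡k → Equivalence.from (twins⇔ (0ₙ n) w) (≡k⇒twin W≡k))
    where
    W = toℕ w
    toℕ-0ₙ : toℕ (0ₙ n) ≡ 0
    toℕ-0ₙ = trans (toℕ-fromℕ< _) (m<n⇒m%n≡m (>-nonZero⁻¹ n))
    W/k<2 : W / k < 2
    W/k<2 = m<n*o⇒m/o<n (subst (W <_) (trans n≡m*k (cong (_* k) m≡2)) (toℕ<n w))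
    twin⇒≡k : 0ₙ n ≢ w × toℕ (0ₙ n) ≈ W → W ≡ k
    twin⇒≡k (0≢w , 0≈W) = multiple (W / k) W/k<2 W≡W/k*k
      where
      W≡W/k*k : W ≡ W / k * k
      W≡W/k*k = trans (m≡m%n+[m/n]*n W k) (cong (_+ W / k * k) (trans (sym 0≈W) (trans (cong (_% k) toℕ-0ₙ) 0%k≡0)))
      multiple : ∀ q → q < 2 → W ≡ q * k → W ≡ k
      multiple 0             _                 W≡0  = ⊥-elim (0≢w (toℕ-injective (trans toℕ-0ₙ (sym W≡0))))
      multiple 1             _                 W≡1k = trans W≡1k (*-identityˡ k)
      multiple (suc (suc q)) (s<s (s<s ()))    _
    ≡k⇒twin : W ≡ k → 0ₙ n ≢ w × toℕ (0ₙ n) ≈ W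
    ≡k⇒twin W≡k = (λ 0≡w → ≢-nonZero⁻¹ k (trans (sym W≡k) (trans (cong toℕ (sym 0≡w)) toℕ-0ₙ)))
                , trans (cong (_% k) toℕ-0ₙ) (trans (sym k≈0) (cong (_% k) (sym W≡k)))

  valency-1⇒bipartite : ConnectionSet n S → Connected X → δ ≡ 1 → X ≅ CompleteBipartite m m
  valency-1⇒bipartite cs conn δ≡1 = ≅-trans X≅Y≀Empty (≅-trans
    (≀Empty-congˡ m (valency-one-circulant k T (Y-connectionSet cs) (Y-connected conn) (trans Y-valency δ≡1)))
    (≅-sym (K[m,m]≅K[1,1]≀Empty m)))

  prime-valency : ConnectionSet n S → Connected X → 2 ≤ m → Prime (δ * m) →
                  X ≅ CompleteBipartite (δ * m) (δ * m)
  prime-valency cs conn 2≤m δm-prime =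
    subst (λ z → X ≅ CompleteBipartite z z) (sym δm≡m) (valency-1⇒bipartite cs conn δ≡1)
    where
    δ≡1 : δ ≡ 1
    δ≡1 = Prime[m*n]⇒m≡1 δ m 2≤m δm-prime
    δm≡m : δ * m ≡ m
    δm≡m = trans (cong (_* m) δ≡1) (*-identityˡ m)

  valency-4 : ConnectionSet n S → Connected X → 2 ≤ m → δ * m ≡ 4 →
    (X ≅ CompleteBipartite 4 4) ⊎
    (Σ ℕ λ ℓ → 2 * ℓ ≡ n × 3 ≤ ℓ × (X ≅ Cycle ℓ ≀ Empty 2) × ((w : Fin n) → Twins X (0ₙ n) w ⇔ toℕ w ≡ ℓ))
  valency-4 cs conn 2≤m δm≡4 with m*n≡4⇒ δ m 2≤m δm≡4
  ... | inj₁ (δ≡1 , m≡4) =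
    inj₁ (subst (λ z → X ≅ CompleteBipartite z z) m≡4 (valency-1⇒bipartite cs conn δ≡1))
  ... | inj₂ (δ≡2 , m≡2)
    with valency-two-circulant k T (Y-connectionSet cs) (Y-connected conn) (trans Y-valency δ≡2)
  ...   | 3≤k , Y≅C = inj₂ (k , sym (trans n≡m*k (cong (_* k) m≡2)) , 3≤k ,
            subst (λ z → X ≅ Cycle k ≀ Empty z) m≡2 (≅-trans X≅Y≀Empty (≀Empty-congˡ m Y≅C)) , twins-of-0 m≡2)

lemma2p15 : (n : ℕ) .{{nz : NonZero n}} (S : Subset n) → ConnectionSet n S
    → Connected (Cay n S) → ¬ TwinFree (Cay n S) → (d : ℕ) → Regular (Cay n S) d
    → (Σ ℕ λ k → Σ (NonZero k) λ nzk → Σ (Subset k) λ T →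
         ConnectionSet k {{nzk}} T × Connected (Cay k {{nzk}} T) ×
         Σ ℕ λ m → 2 ≤ m × (Cay n S ≅ Cay k {{nzk}} T ≀ Empty m) ×
         Σ ℕ λ δ → Regular (Cay k {{nzk}} T) δ × d ≡ δ * m)
      × (Prime d → Cay n S ≅ CompleteBipartite d d)
      × (d ≡ 4 → (Cay n S ≅ CompleteBipartite 4 4)
           ⊎ (Σ ℕ λ ℓ → 2 * ℓ ≡ n × 3 ≤ ℓ × (Cay n S ≅ Cycle ℓ ≀ Empty 2)
                × ((w : Fin n) → Twins (Cay n S) (0ₙ n) w ⇔ toℕ w ≡ ℓ)))
lemma2p15 n S cs conn not-twin-free d reg
  with least (Circulant.positive-period? n S) (>-nonZero⁻¹ n , Circulant.inS-periodic n S)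
... | k , (0<k , k-period) , k-least =
  (k , nzk , T , Y-connectionSet cs , Y-connected conn , m , 2≤m , X≅Y≀Empty , δ , Y-regular , d≡δ*m) ,
  (λ d-prime → subst (λ z → X ≅ CompleteBipartite z z) (sym d≡δ*m)
                 (prime-valency cs conn 2≤m (subst Prime d≡δ*m d-prime))) ,
  (λ d≡4 → valency-4 cs conn 2≤m (trans (sym d≡δ*m) d≡4))
  where
  nzk : NonZero k
  nzk = >-nonZero 0<k
  open LeastPeriod n S k {{nzk}} k-period k-least
  2≤m : 2 ≤ m
  2≤m = k<n⇒2≤m (¬TwinFree⇒k<n not-twin-free)
  d≡δ*m : d ≡ δ * m
  d≡δ*m = trans (sym (reg (0ₙ n))) (trans (X-regular (0ₙ n)) (*-comm m δ))
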